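{- Let $\mathcal{M} = (\Sigma, S, \{R_a\}_{a \in \Sigma}, R_D, R_C, \mathbf{AP}, L)$ be a multi-agent epistemic model and let $\theta$ be a formula satisfied at some state of $\mathcal{M}$. Define $L^+ : S \to \mathcal{P}(\mathcal{L})$ by $L^+(s) = \{\varphi \in \mathcal{L} : \mathcal{M}, s \models \varphi\}$. Then $(\Sigma, S, \{R_a\}_{a \in \Sigma}, R_D, R_C, L^+)$ is a multi-agent epistemic Hintikka structure for $\theta$.
   Context: Fix a nonempty set $\mathbf{AP}$ of atomic propositions and a finite set $\Sigma$ of agents with at least two elements. The language $\mathcal{L}$ is given by $\varphi ::= p \mid \neg\varphi \mid \varphi_1 \wedge \varphi_2 \mid K_a\varphi \mid D\varphi \mid C\varphi$, with $p \in \mathbf{AP}$, $a \in \Sigma$. A multi-agent epistemic structure (MAES) is a tuple $(\Sigma, S, \{R_a\}_{a\in\Sigma}, R_D, R_C)$ with $S\neq\emptyset$, $R_a, R_D$ binary relations on $S$, and $R_C$ the transitive closure of $R_D \cup \bigcup_{a} R_a$. A multi-agent epistemic model (MAEM) is such a structure in which every $R_a$ and $R_D$ is an equivalence relation and $R_D = \bigcap_{a \in \Sigma} R_a$, together with a labeling $L : S \to \mathcal{P}(\mathbf{AP})$. Satisfaction is standard: $p$ holds at $s$ iff $p\in L(s)$, Booleans as usual, $\mathcal{M},s\models K_a\varphi$ iff $\varphi$ holds at all $t$ with $(s,t)\in R_a$, and similarly $D$ with $R_D$ and $C$ with $R_C$. A set $\Delta \subseteq \mathcal{L}$ is fully expanded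 if: $\neg\neg\varphi\in\Delta$ implies $\varphi\in\Delta$; $\varphi\wedge\psi\in\Delta$ implies $\varphi,\psi\in\Delta$; $\neg(\varphi\wedge\psi)\in\Delta$ implies $\neg\varphi\in\Delta$ or $\neg\psi\in\Delta$; $K_a\varphi\in\Delta$ implies $D\varphi\in\Delta$; $D\varphi\in\Delta$ implies $\varphi\in\Delta$; $C\varphi\in\Delta$ implies $K_a(\varphi\wedge C\varphi)\in\Delta$ for every $a\in\Sigma$; $\neg C\varphi\in\Delta$ implies $\neg K_a(\varphi\wedge C\varphi)\in\Delta$ for some $a\in\Sigma$; and if $\varphi\in\Delta$ and $\psi$ is a subformula of $\varphi$ of the form $K_a\chi$ or $D\chi$, then $\psi\in\Delta$ or $\neg\psi\in\Delta$. A multi-agent epistemic Hintikka structure (MAEHS) is a tuple $(\Sigma, S, \{R_a\}, R_D, R_C, H)$ where $(\Sigma,S,\{R_a\},R_D,R_C)$ is a MAES and $H$ assigns to each $s\in S$ a set $H(s)\subseteq\mathcal{L}$ such that: (H1) if $\neg\varphi\in H(s)$ then $\varphi\notin H(s)$; (H2) each $H(s)$ is fully expanded; (H3) if $K_a\varphi\in H(s)$ and $(s,t)\in R_a$ then $\varphi\in H(t)$; (H4) if $\neg K_a\varphi\in H(s)$ then there is $t$ with $(s,t)\in R_a$ and $\neg\varphi\in H(t)$; (H5) if $(s,t)\in R_a$ then $K_a\varphi\in H(s)$ iff $K_a\varphi\in H(t)$; (H6) if $D\varphi\in H(s)$ and $(s,t)\in R_D$ then $\varphi\in H(t)$; (H7)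 if $\neg D\varphi\in H(s)$ then there is $t$ with $(s,t)\in R_D$ and $\neg\varphi\in H(t)$; (H8) if $(s,t)\in R_D$ then $D\varphi\in H(s)$ iff $D\varphi\in H(t)$, and $K_a\varphi\in H(s)$ iff $K_a\varphi\in H(t)$ for every $a\in\Sigma$; (H9) if $\neg C\varphi\in H(s)$ then there is $t$ with $(s,t)\in R_C$ and $\neg\varphi\in H(t)$. It is a MAEHS for $\theta$ if $\theta\in H(s)$ for some $s\in S$. -}

module Defs where

open import Data.Product using (Σ; ∃; _×_; _,_)
open import Data.Sum using (_⊎_)
open import Data.Empty using (⊥)
open import Relation.Nullary using (¬_)
open import Relation.Binary.Core using (Rel)
open import Relation.Binary.Structures using (IsEquivalence)
open import Relation.Binary.Construct.Closure.Transitive using (TransClosure)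
open import Function.Bundles using (_⇔_)

infix  6 ~_
infixr 5 _∧_

data Formula (AP Agent : Set) : Set where
  atom : AP → Formula AP Agent
  ~_   : Formula AP Agent → Formula AP Agent
  _∧_  : Formula AP Agent → Formula AP Agent → Formula AP Agent
  K    : Agent → Formula AP Agent → Formula AP Agent
  D    : Formula AP Agent → Formula AP Agent
  C    : Formula AP Agent → Formula AP Agent

module _ {AP Agent : Set} where

  data Sub : Formula AP Agent → Formula AP Agent → Set where
    here  : ∀ {φ} → Sub φ φ
    in-~  : ∀ {ψ φ} → Sub ψ φ → Sub ψ (~ φ)
    in-∧ˡ : ∀ {ψ φ χ} → Sub ψ φ → Sub ψ (φ ∧ χ)
    in-∧ʳ : ∀ {ψ φ χ} → Sub ψ χ → Sub ψ (φ ∧ χ)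
    in-K  : ∀ {ψ a φ} → Sub ψ φ → Sub ψ (K a φ)
    in-D  : ∀ {ψ φ} → Sub ψ φ → Sub ψ (D φ)
    in-C  : ∀ {ψ φ} → Sub ψ φ → Sub ψ (C φ)

  data IsKD : Formula AP Agent → Set where
    isK : ∀ {a χ} → IsKD (K a χ)
    isD : ∀ {χ} → IsKD (D χ)

  FSet : Set₁
  FSet = Formula AP Agent → Set

  record FullyExpanded (Δ : FSet) : Set where
    field
      fe-¬¬  : ∀ {φ} → Δ (~ ~ φ) → Δ φ
      fe-∧   : ∀ {φ ψ} → Δ (φ ∧ ψ) → Δ φ × Δ ψ
      fe-¬∧  : ∀ {φ ψ} → Δ (~ (φ ∧ ψ)) → Δ (~ φ) ⊎ Δ (~ ψ)
      fe-K   : ∀ {a φ} → Δ (K a φ) → Δ (D φ)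
      fe-D   : ∀ {φ} → Δ (D φ) → Δ φ
      fe-C   : ∀ {φ} → Δ (C φ) → ∀ a → Δ (K a (φ ∧ C φ))
      fe-¬C  : ∀ {φ} → Δ (~ C φ) → ∃ λ a → Δ (~ K a (φ ∧ C φ))
      fe-sub : ∀ {φ ψ} → Δ φ → Sub ψ φ → IsKD ψ → Δ ψ ⊎ Δ (~ ψ)

record MAES (Agent : Set) : Set₁ where
  field
    S   : Set
    s₀  : S                       -- S ≠ ∅
    R   : Agent → Rel S _
    RD  : Rel S _

  Step : Rel S _
  Step s t = RD s t ⊎ Σ Agent (λ a → R a s t)

  RC : Rel S _
  RC = TransClosure Step

record MAEM (AP Agent : Set) : Set₁ where
  field
    structure : MAES Agent
  open MAES structure public
  field
    R-equiv  : ∀ a → IsEquivalence (R a)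
    RD-equiv : IsEquivalence RD
    RD-∩     : ∀ s t → RD s t ⇔ (∀ a → R a s t)
    L        : S → AP → Set

module _ {AP Agent : Set} where

  _,_⊨_ : (M : MAEM AP Agent) → MAEM.S M → Formula AP Agent → Set
  M , s ⊨ atom p  = MAEM.L M s p
  M , s ⊨ (~ φ)   = ¬ (M , s ⊨ φ)
  M , s ⊨ (φ ∧ ψ) = (M , s ⊨ φ) × (M , s ⊨ ψ)
  M , s ⊨ K a φ   = ∀ t → MAEM.R M a s t → M , t ⊨ φ
  M , s ⊨ D φ     = ∀ t → MAEM.RD M s t → M , t ⊨ φ
  M , s ⊨ C φ     = ∀ t → MAEM.RC M s t → M , t ⊨ φ

  record IsMAEHS (𝒮 : MAES Agent)
                 (H : MAES.S 𝒮 → Formula AP Agent → Set) : Set where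
    open MAES 𝒮
    field
      H1 : ∀ s φ → H s (~ φ) → ¬ H s φ
      H2 : ∀ s → FullyExpanded (H s)
      H3 : ∀ s t a φ → H s (K a φ) → R a s t → H t φ
      H4 : ∀ s a φ → H s (~ K a φ) → ∃ λ t → R a s t × H t (~ φ)
      H5 : ∀ s t a φ → R a s t → H s (K a φ) ⇔ H t (K a φ)
      H6 : ∀ s t φ → H s (D φ) → RD s t → H t φ
      H7 : ∀ s φ → H s (~ D φ) → ∃ λ t → RD s t × H t (~ φ)
      H8 : ∀ s t → RD s t →
             (∀ φ → H s (D φ) ⇔ H t (D φ)) ×
             (∀ a φ → H s (K a φ) ⇔ H t (K a φ))
      H9 : ∀ s φ → H s (~ C φ) → ∃ λ t → RC s t × H t (~ φ)

  record IsMAEHSFor (𝒮 : MAES Agent)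
                    (H : MAES.S 𝒮 → Formula AP Agent → Set)
                    (θ : Formula AP Agent) : Set where
    field
      isMAEHS : IsMAEHS 𝒮 H
      θ-in    : ∃ λ s → H s θ

module Submission where

-- Clauses H3–H9 are read off the satisfaction clauses of K, D and C, using that
-- the R_a and R_D are equivalence relations with R_D ⊆ R_a; H1 and the
-- disjunctive and existential closure conditions are instances of excluded
-- middle.  The one non-local step is the fixpoint property of C: if
-- K_a(φ ∧ Cφ) holds for every agent a then so does Cφ, and covering the
-- R_D-steps of a path there needs some agent, which 2 ≤ n provides.

open import Defs
open import Data.Nat using (ℕ; _≤_; suc)
open import Data.Fin using (Fin; zero)
open import Data.Product using (∃; _×_; _,_; proj₁; proj₂)
open import Data.Sum using (_⊎_; inj₁; inj₂)
open import Function using (_∘_)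
open import Function.Bundles using (_⇔_; mk⇔; Equivalence)
open import Level using (0ℓ)
open import Relation.Nullary using (¬_; contraposition; contradiction)
open import Relation.Nullary.Decidable using (toSum)
open import Relation.Nullary.Negation using (¬∃⟶∀¬)
open import Relation.Binary.Structures using (IsEquivalence)
open import Relation.Binary.Construct.Closure.Transitive using ([_]; _∷_)
open import Axiom.ExcludedMiddle using (ExcludedMiddle)
open import Axiom.DoubleNegationElimination using (em⇒dne)

module Classical (em : ExcludedMiddle 0ℓ) where

  ¬×⇒¬⊎¬ : {A B : Set} → ¬ (A × B) → ¬ A ⊎ ¬ B
  ¬×⇒¬⊎¬ ¬a×b with toSum em
  ... | inj₁ a  = inj₂ (λ b → ¬a×b (a , b))
  ... | inj₂ ¬a = inj₁ ¬a

  ¬∀⇒∃¬ : {X : Set} {P : X → Set} → ¬ (∀ x → P x) → ∃ λ x → ¬ P x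
  ¬∀⇒∃¬ ¬∀ = em⇒dne em λ ¬∃ → ¬∀ (λ x → em⇒dne em (¬∃⟶∀¬ ¬∃ x))

  ¬→⇒×¬ : {A B : Set} → ¬ (A → B) → A × ¬ B
  ¬→⇒×¬ ¬a→b = em⇒dne em (λ ¬a → ¬a→b (λ a → contradiction a ¬a)) , λ b → ¬a→b (λ _ → b)

  ¬∀⇒∃×¬ : {X : Set} {P Q : X → Set} → ¬ (∀ x → P x → Q x) → ∃ λ x → P x × ¬ Q x
  ¬∀⇒∃×¬ ¬∀ with ¬∀⇒∃¬ ¬∀
  ... | x , ¬p→q = x , ¬→⇒×¬ ¬p→q

module _ {AP Agent : Set} (M : MAEM AP Agent) where
  open MAEM M
  private
    module R a = IsEquivalence (R-equiv a)
    module RD = IsEquivalence RD-equiv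

  RD⇒R : ∀ {s t} a → RD s t → R a s t
  RD⇒R {s} {t} a r = Equivalence.to (RD-∩ s t) r a

  K-transport : ∀ {s t} a φ → R a s t → M , s ⊨ K a φ → M , t ⊨ K a φ
  K-transport a φ s~t k u t~u = k u (R.trans a s~t t~u)

  K-invariant : ∀ {s t} a φ → R a s t → (M , s ⊨ K a φ) ⇔ (M , t ⊨ K a φ)
  K-invariant a φ s~t = mk⇔ (K-transport a φ s~t) (K-transport a φ (R.sym a s~t))

  D-transport : ∀ {s t} φ → RD s t → M , s ⊨ D φ → M , t ⊨ D φ
  D-transport φ s~t d u t~u = d u (RD.trans s~t t~u)

  D-invariant : ∀ {s t} φ → RD s t → (M , s ⊨ D φ) ⇔ (M , t ⊨ D φ)
  D-invariant φ s~t = mk⇔ (D-transport φ s~t) (D-transport φ (RD.sym s~t))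

  K⇒D : ∀ {s} a φ → M , s ⊨ K a φ → M , s ⊨ D φ
  K⇒D a φ k t r = k t (RD⇒R a r)

  D⇒T : ∀ {s} φ → M , s ⊨ D φ → M , s ⊨ φ
  D⇒T φ d = d _ RD.refl

  C-unfold : ∀ {s} φ → M , s ⊨ C φ → ∀ a → M , s ⊨ K a (φ ∧ C φ)
  C-unfold φ c a t r = c t [ inj₂ (a , r) ] , λ u p → c u (inj₂ (a , r) ∷ p)

  everyone-knows⇒Step : Agent → ∀ {s u} ψ → (∀ a → M , s ⊨ K a ψ) → Step s u → M , u ⊨ ψ
  everyone-knows⇒Step a₀ ψ k (inj₁ r)       = k a₀ _ (RD⇒R a₀ r)
  everyone-knows⇒Step a₀ ψ k (inj₂ (a , r)) = k a _ r

  C-fold : Agent → ∀ {s} φ → (∀ a → M , s ⊨ K a (φ ∧ C φ)) → M , s ⊨ C φ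
  C-fold a₀ φ k t [ x ]   = proj₁ (everyone-knows⇒Step a₀ (φ ∧ C φ) k x)
  C-fold a₀ φ k t (x ∷ p) = proj₂ (everyone-knows⇒Step a₀ (φ ∧ C φ) k x) t p

  module _ (em : ExcludedMiddle 0ℓ) (a₀ : Agent) where
    open Classical em

    ⊨-fullyExpanded : ∀ s → FullyExpanded (M , s ⊨_)
    ⊨-fullyExpanded s = record
      { fe-¬¬  = em⇒dne em
      ; fe-∧   = λ φ∧ψ → φ∧ψ
      ; fe-¬∧  = ¬×⇒¬⊎¬
      ; fe-K   = λ {a} {φ} → K⇒D a φ
      ; fe-D   = λ {φ} → D⇒T φ
      ; fe-C   = λ {φ} → C-unfold φ
      ; fe-¬C  = λ {φ} → ¬∀⇒∃¬ ∘ contraposition (C-fold a₀ φ)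
      ; fe-sub = λ _ _ _ → toSum em
      }

    ⊨-isMAEHS : IsMAEHS structure (M ,_⊨_)
    ⊨-isMAEHS = record
      { H1 = λ _ _ ¬φ → ¬φ
      ; H2 = ⊨-fullyExpanded
      ; H3 = λ _ t _ _ k r → k t r
      ; H4 = λ _ _ _ → ¬∀⇒∃×¬
      ; H5 = λ _ _ a φ → K-invariant a φ
      ; H6 = λ _ t _ d r → d t r
      ; H7 = λ _ _ → ¬∀⇒∃×¬
      ; H8 = λ _ _ r → (λ φ → D-invariant φ r) , (λ a φ → K-invariant a φ (RD⇒R a r))
      ; H9 = λ _ _ → ¬∀⇒∃×¬
      }

lemma1 : ExcludedMiddle 0ℓ →
         {AP : Set} → AP →
         (n : ℕ) → 2 ≤ n →
         (M : MAEM AP (Fin n)) →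
         (θ : Formula AP (Fin n)) →
         (∃ λ s → M , s ⊨ θ) →
         IsMAEHSFor (MAEM.structure M) (λ s φ → M , s ⊨ φ) θ
lemma1 em _ (suc _) _ M θ θ-sat = record
  { isMAEHS = ⊨-isMAEHS M em zero
  ; θ-in    = θ-sat
  }
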